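{- For every $I\in\mathbb{Z}$ there exist integers $\mathsf{pred}_L(I)\le\mathsf{pred}_R(I)\le I-1$ such that, for every integer $J$, $[J..I-1]$ is a stable segment if and only if $\mathsf{pred}_L(I)\le J\le\mathsf{pred}_R(I)$. Moreover, for every $I$: (1) $\mathsf{pred}_L(I)\le\mathsf{pred}_L(I+1)$; (2) $\mathsf{pred}_R(I)\le\mathsf{pred}_R(I+1)$.
   Context: Setting: $L\ge1$, $X=Y$ is a string of length $L$ over $\Sigma$, and $E_0=\{(i_1,j_1),\dots,(i_M,j_M)\}\subseteq[L]^2$ with $i_t>j_t$, $X[i_t]=Y[j_t]$, $i_1<\dots<i_M$, $j_1<\dots<j_M$. Extend $X,Y$ to $\mathbb{Z}$ by $X[i]=Y[i]=X[L]$ for $i>L$ and $X[i]=Y[i]=X[1]$ for $i<1$; matched edges are $E=E_0\cup\{(i,i-1): i>L\text{ or } i\le1\}$ (non-intersecting, each edge $(I,J)$ has $I>J$). A segment $[l..r]$ ($l\le r$) is stable if for every $(I,J)\in E$ exactly one holds: ($J<l$ and $I\le r$) or ($J\ge l$ and $I>r$). -}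

module Defs where

open import Data.Nat as ℕ using (ℕ; suc)
open import Data.Integer using (ℤ; +_; _-_; _<_; _≤_)
open import Data.Fin using (Fin; toℕ)
open import Data.Vec using (Vec; lookup)
open import Data.List using (List)
open import Data.List.Membership.Propositional using (_∈_)
open import Data.List.Relation.Unary.All using (All)
open import Data.List.Relation.Unary.Linked using (Linked)
open import Data.Product using (Σ; _×_; proj₁; proj₂)
open import Data.Sum using (_⊎_)
open import Relation.Nullary using (¬_)
open import Relation.Binary.PropositionalEquality using (_≡_)

-- Position i : Fin L denotes the 1-based index (toℕ i + 1) ∈ [L] = {1,…,L}.
pos : ∀ {L} → Fin L → ℤ
pos i = + suc (toℕ i)

Edge : ℕ → Set
Edge L = Fin L × Fin L

-- Hypotheses on E₀ (with Y = X): i_t > j_t, X[i_t] = Y[j_t],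
-- and both coordinates strictly increasing along the list.
ValidE0 : {A : Set} (L : ℕ) → Vec A L → List (Edge L) → Set
ValidE0 L X E0 =
  All (λ e → (toℕ (proj₂ e) ℕ.< toℕ (proj₁ e)) × (lookup X (proj₁ e) ≡ lookup X (proj₂ e))) E0
  × Linked (λ e e′ → (toℕ (proj₁ e) ℕ.< toℕ (proj₁ e′)) × (toℕ (proj₂ e) ℕ.< toℕ (proj₂ e′))) E0

InE : (L : ℕ) → List (Edge L) → ℤ → ℤ → Set
InE L E0 I J =
  (Σ (Edge L) λ e → (e ∈ E0) × (I ≡ pos (proj₁ e)) × (J ≡ pos (proj₂ e)))
  ⊎ (((+ L < I) ⊎ (I ≤ + 1)) × (J ≡ I - + 1))

ExactlyOne : Set → Set → Set
ExactlyOne P Q = (P × ¬ Q) ⊎ (¬ P × Q)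

Stable : (L : ℕ) → List (Edge L) → ℤ → ℤ → Set
Stable L E0 l r =
  (l ≤ r) ×
  (∀ I J → InE L E0 I J → ExactlyOne ((J < l) × (I ≤ r)) ((l ≤ J) × (r < I)))

-- [J..r] is stable iff J ≤ r, every edge with source ≤ r has target < J, and every edge
-- with source > r has target ≥ J. As E₀ is finite and the boundary edges (i, i − 1) cover
-- every source outside [2..L], the targets of edges with source ≤ r have a largest element b
-- and those with source > r a smallest element b′; so the stable J are exactly
-- b + 1 ≤ J ≤ min b′ r, and predL(I), predR(I) are these bounds at r = I − 1. Both bounds
-- grow with r because raising r enlarges the first set of edges and shrinks the second,
-- and b < b′ because edges do not cross.
module Submission where

open import Defs
open import Data.Nat using (ℕ)
open import Data.Integer using (ℤ; +_; _+_; _-_; _≤_)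
open import Data.Vec using (Vec)
open import Data.List using (List)
open import Data.Product using (Σ; _×_)
open import Function.Bundles using (_⇔_)

import Data.Nat as ℕ
import Data.Nat.Properties as ℕ
open import Data.Integer using (_<_; _⊓_; -_; -1ℤ; +≤+; +<+; -<+) renaming (suc to sucℤ)
open import Data.Integer.Properties
open import Data.Fin using (Fin; toℕ)
open import Data.Fin.Properties using (toℕ<n)
open import Data.List using (map; filter)
open import Data.List.Membership.Propositional using (_∈_)
open import Data.List.Membership.Propositional.Properties using (∈-map⁺; ∈-filter⁺; ∈-map∘filter⁻)
open import Data.List.Extrema ≤-totalOrder using (max; min; argmax-sel; argmin-sel; xs≤max; ⊥≤max; min≤xs; min≤⊤)
open import Data.List.Relation.Unary.Any using (here; there)
import Data.List.Relation.Unary.All as All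
open import Data.List.Relation.Unary.AllPairs using (AllPairs; _∷_)
open import Data.List.Relation.Unary.Linked.Properties using (Linked⇒AllPairs)
open import Data.Product using (_,_; proj₁; proj₂)
open import Data.Sum using (_⊎_; inj₁; inj₂)
open import Data.Empty using (⊥-elim)
open import Function.Base using (id)
open import Function.Bundles using (mk⇔; module Equivalence)
open import Relation.Binary.Construct.Union using (_∪_)
open import Relation.Nullary using (yes; no)
open import Relation.Nullary.Decidable using (_⊎-dec_)
open import Relation.Binary.PropositionalEquality using (_≡_; refl; sym; trans; subst)

record LastEdgeUpTo (E : ℤ → ℤ → Set) (r : ℤ) : Set where
  field
    src tgt     : ℤ
    edge        : E src tgt
    src≤r       : src ≤ r
    tgt-maximal : ∀ {I J} → E I J → I ≤ r → J ≤ tgt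

record FirstEdgeAfter (E : ℤ → ℤ → Set) (r : ℤ) : Set where
  field
    src tgt     : ℤ
    edge        : E src tgt
    r<src       : r < src
    tgt-minimal : ∀ {I J} → E I J → r < I → tgt ≤ J

module StableSegments
  (E : ℤ → ℤ → Set)
  (tgt<src : ∀ {I J} → E I J → J < I)
  (monotone : ∀ {I J I′ J′} → E I J → E I′ J′ → I < I′ → J < J′)
  (last : ∀ r → LastEdgeUpTo E r)
  (first : ∀ r → FirstEdgeAfter E r)
  where

  open Equivalence using (to; from)

  EdgesRespect : ℤ → ℤ → Set
  EdgesRespect l r = ∀ I J → E I J → ExactlyOne ((J < l) × (I ≤ r)) ((l ≤ J) × (r < I))

  IsStable : ℤ → ℤ → Set
  IsStable l r = (l ≤ r) × EdgesRespect l r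

  TargetsBelow : ℤ → ℤ → Set
  TargetsBelow l r = ∀ {I J} → E I J → I ≤ r → J < l

  TargetsFrom : ℤ → ℤ → Set
  TargetsFrom l r = ∀ {I J} → E I J → r < I → l ≤ J

  edgesRespect⇔ : ∀ {l r} → EdgesRespect l r ⇔ (TargetsBelow l r × TargetsFrom l r)
  edgesRespect⇔ {l} {r} = mk⇔ split respect
    where
    targetsBelow : EdgesRespect l r → TargetsBelow l r
    targetsBelow respects {I} {J} e I≤r with respects I J e
    ... | inj₁ ((J<l , _) , _) = J<l
    ... | inj₂ (_ , (_ , r<I)) = ⊥-elim (<⇒≱ r<I I≤r)
    targetsFrom : EdgesRespect l r → TargetsFrom l r
    targetsFrom respects {I} {J} e r<I with respects I J e
    ... | inj₁ ((_ , I≤r) , _) = ⊥-elim (<⇒≱ r<I I≤r)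
    ... | inj₂ (_ , (l≤J , _)) = l≤J
    split : EdgesRespect l r → TargetsBelow l r × TargetsFrom l r
    split respects = targetsBelow respects , targetsFrom respects
    respect : TargetsBelow l r × TargetsFrom l r → EdgesRespect l r
    respect (below , above) I J e with I ≤? r
    ... | yes I≤r = inj₁ ((below e I≤r , I≤r) , λ (_ , r<I) → <⇒≱ r<I I≤r)
    ... | no I≰r  = inj₂ ((λ (_ , I≤r) → I≰r I≤r) , (above e (≰⇒> I≰r) , ≰⇒> I≰r))

  predL : ℤ → ℤ
  predL r = sucℤ (LastEdgeUpTo.tgt (last r))

  predR : ℤ → ℤ
  predR r = FirstEdgeAfter.tgt (first r) ⊓ r

  targetsBelow⇔ : ∀ {l r} → TargetsBelow l r ⇔ predL r ≤ l
  targetsBelow⇔ {l} {r} = mk⇔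
    (λ tb → i<j⇒suc[i]≤j (tb edge src≤r))
    (λ predL≤l {I} {J} e I≤r → suc[i]≤j⇒i<j (≤-trans (suc-mono (tgt-maximal e I≤r)) predL≤l))
    where open LastEdgeUpTo (last r)

  targetsFrom⇔ : ∀ {l r} → TargetsFrom l r ⇔ l ≤ FirstEdgeAfter.tgt (first r)
  targetsFrom⇔ {l} {r} = mk⇔
    (λ tf → tf edge r<src)
    (λ l≤tgt {I} {J} e r<I → ≤-trans l≤tgt (tgt-minimal e r<I))
    where open FirstEdgeAfter (first r)

  stable⇔ : ∀ l r → IsStable l r ⇔ (predL r ≤ l × l ≤ predR r)
  stable⇔ l r = mk⇔
    (λ (l≤r , respect) → let (below , above) = to edgesRespect⇔ respect in
       to targetsBelow⇔ below , ⊓-glb (to targetsFrom⇔ above) l≤r)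
    (λ (predL≤l , l≤predR) →
       ≤-trans l≤predR (i⊓j≤j _ r) ,
       from edgesRespect⇔ (from targetsBelow⇔ predL≤l , from targetsFrom⇔ (≤-trans l≤predR (i⊓j≤i _ r))))

  predR≤r : ∀ r → predR r ≤ r
  predR≤r r = i⊓j≤j _ r

  predL≤predR : ∀ r → predL r ≤ predR r
  predL≤predR r = ⊓-glb (i<j⇒suc[i]≤j (monotone L.edge F.edge (≤-<-trans L.src≤r F.r<src)))
                        (i<j⇒suc[i]≤j (<-≤-trans (tgt<src L.edge) L.src≤r))
    where
    module L = LastEdgeUpTo (last r)
    module F = FirstEdgeAfter (first r)

  predL-mono : ∀ {r r′} → r ≤ r′ → predL r ≤ predL r′
  predL-mono {r} {r′} r≤r′ = suc-mono (LastEdgeUpTo.tgt-maximal (last r′) L.edge (≤-trans L.src≤r r≤r′))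
    where module L = LastEdgeUpTo (last r)

  predR-mono : ∀ {r r′} → r ≤ r′ → predR r ≤ predR r′
  predR-mono {r} {r′} r≤r′ = ⊓-mono-≤ (FirstEdgeAfter.tgt-minimal (first r) F.edge (≤-<-trans r≤r′ F.r<src)) r≤r′
    where module F = FirstEdgeAfter (first r′)

module _ {T : Set} (source target : T → ℤ) (xs : List T) where

  ListEdges : ℤ → ℤ → Set
  ListEdges I J = Σ T λ e → e ∈ xs × I ≡ source e × J ≡ target e

  lastEdgeUpTo-∪ : ∀ {B r} → LastEdgeUpTo B r → LastEdgeUpTo (ListEdges ∪ B) r
  lastEdgeUpTo-∪ {B} {r} lastB = record
    { src = proj₁ attained ; tgt = m ; edge = proj₁ (proj₂ attained) ; src≤r = proj₂ (proj₂ attained)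
    ; tgt-maximal = maximal }
    where
    open LastEdgeUpTo lastB using (src; tgt; edge; src≤r; tgt-maximal)
    candidates : List ℤ
    candidates = map target (filter (λ e → source e ≤? r) xs)
    m : ℤ
    m = max tgt candidates
    attained : Σ ℤ λ a → (ListEdges ∪ B) a m × a ≤ r
    attained with argmax-sel id tgt candidates
    ... | inj₁ m≡tgt = src , inj₂ (subst (B src) (sym m≡tgt) edge) , src≤r
    ... | inj₂ m∈ with ∈-map∘filter⁻ target _ m∈
    ...   | e , e∈xs , m≡ , e≤r = source e , inj₁ (e , e∈xs , refl , m≡) , e≤r
    maximal : ∀ {I J} → (ListEdges ∪ B) I J → I ≤ r → J ≤ m
    maximal (inj₁ (e , e∈xs , refl , refl)) I≤r =
      All.lookup (xs≤max tgt candidates) (∈-map⁺ target (∈-filter⁺ _ e∈xs I≤r))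
    maximal (inj₂ b) I≤r = ≤-trans (tgt-maximal b I≤r) (⊥≤max tgt candidates)

  firstEdgeAfter-∪ : ∀ {B r} → FirstEdgeAfter B r → FirstEdgeAfter (ListEdges ∪ B) r
  firstEdgeAfter-∪ {B} {r} firstB = record
    { src = proj₁ attained ; tgt = m ; edge = proj₁ (proj₂ attained) ; r<src = proj₂ (proj₂ attained)
    ; tgt-minimal = minimal }
    where
    open FirstEdgeAfter firstB using (src; tgt; edge; r<src; tgt-minimal)
    candidates : List ℤ
    candidates = map target (filter (λ e → r <? source e) xs)
    m : ℤ
    m = min tgt candidates
    attained : Σ ℤ λ a → (ListEdges ∪ B) a m × r < a
    attained with argmin-sel id tgt candidates
    ... | inj₁ m≡tgt = src , inj₂ (subst (B src) (sym m≡tgt) edge) , r<src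
    ... | inj₂ m∈ with ∈-map∘filter⁻ target _ m∈
    ...   | e , e∈xs , m≡ , r<e = source e , inj₁ (e , e∈xs , refl , m≡) , r<e
    minimal : ∀ {I J} → (ListEdges ∪ B) I J → r < I → m ≤ J
    minimal (inj₁ (e , e∈xs , refl , refl)) r<I =
      All.lookup (min≤xs tgt candidates) (∈-map⁺ target (∈-filter⁺ _ e∈xs r<I))
    minimal (inj₂ b) r<I = ≤-trans (min≤⊤ tgt candidates) (tgt-minimal b r<I)

i-1<i : ∀ i → i - + 1 < i
i-1<i i = subst (i - + 1 <_) (+-identityʳ i) (+-monoʳ-< i -<+)

suc[i]-1≡i : ∀ i → sucℤ i - + 1 ≡ i
suc[i]-1≡i i = trans (+-comm (sucℤ i) -1ℤ) (pred-suc i)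

i<j⇒i≤j-1 : ∀ {i j} → i < j → i ≤ j - + 1
i<j⇒i≤j-1 {i} i<j = subst (_≤ _) (suc[i]-1≡i i) (+-monoˡ-≤ (- + 1) (i<j⇒suc[i]≤j i<j))

i<suc[i] : ∀ i → i < sucℤ i
i<suc[i] i = suc[i]≤j⇒i<j ≤-refl

Boundary : ℕ → ℤ → ℤ → Set
Boundary L I J = ((+ L < I) ⊎ (I ≤ + 1)) × (J ≡ I - + 1)

lastBoundaryUpTo : ∀ L r → LastEdgeUpTo (Boundary L) r
lastBoundaryUpTo L r with (+ L <? r) ⊎-dec (r ≤? + 1)
... | yes r-src = record
  { src = r ; tgt = r - + 1 ; edge = r-src , refl ; src≤r = ≤-refl
  ; tgt-maximal = λ { (_ , refl) I≤r → +-monoˡ-≤ (- + 1) I≤r } }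
... | no ¬r-src = record
  { src = + 1 ; tgt = + 0 ; edge = inj₂ ≤-refl , refl ; src≤r = <⇒≤ (≰⇒> (λ r≤1 → ¬r-src (inj₂ r≤1)))
  ; tgt-maximal = λ
      { (inj₁ L<I , refl) I≤r → ⊥-elim (¬r-src (inj₁ (<-≤-trans L<I I≤r)))
      ; (inj₂ I≤1 , refl) _ → +-monoˡ-≤ (- + 1) I≤1 } }

firstBoundaryAfter : ∀ L r → FirstEdgeAfter (Boundary L) r
firstBoundaryAfter L r with (+ L <? sucℤ r) ⊎-dec (sucℤ r ≤? + 1)
... | yes r+1-src = record
  { src = sucℤ r ; tgt = r ; edge = r+1-src , sym (suc[i]-1≡i r) ; r<src = i<suc[i] r
  ; tgt-minimal = λ { (_ , refl) r<I → i<j⇒i≤j-1 r<I } }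
... | no ¬r+1-src = record
  { src = sucℤ (+ L) ; tgt = + L ; edge = inj₁ (i<suc[i] (+ L)) , sym (suc[i]-1≡i (+ L))
  ; r<src = <-trans (suc[i]≤j⇒i<j (≮⇒≥ (λ L<r+1 → ¬r+1-src (inj₁ L<r+1)))) (i<suc[i] (+ L))
  ; tgt-minimal = λ
      { (inj₁ L<I , refl) _ → i<j⇒i≤j-1 L<I
      ; (inj₂ I≤1 , refl) r<I → ⊥-elim (¬r+1-src (inj₂ (≤-trans (i<j⇒suc[i]≤j r<I) I≤1))) } }

AllPairs-trichotomy : ∀ {T : Set} {R : T → T → Set} {xs x y} → AllPairs R xs → x ∈ xs → y ∈ xs →
                      x ≡ y ⊎ R x y ⊎ R y x
AllPairs-trichotomy (_ ∷ _)   (here refl) (here refl) = inj₁ refl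
AllPairs-trichotomy (Rx ∷ _)  (here refl) (there y∈)  = inj₂ (inj₁ (All.lookup Rx y∈))
AllPairs-trichotomy (Rx ∷ _)  (there x∈)  (here refl) = inj₂ (inj₂ (All.lookup Rx x∈))
AllPairs-trichotomy (_ ∷ Rxs) (there x∈)  (there y∈)  = AllPairs-trichotomy Rxs x∈ y∈

1≤pos : ∀ {L} (i : Fin L) → + 1 ≤ pos i
1≤pos i = +≤+ (ℕ.s≤s ℕ.z≤n)

pos≤L : ∀ {L} (i : Fin L) → pos i ≤ + L
pos≤L i = +≤+ (toℕ<n i)

module ValidEdges {A : Set} {L : ℕ} (X : Vec A L) {E0 : List (Edge L)} (valid : ValidE0 L X E0) where

  E0-tgt<src : ∀ {e} → e ∈ E0 → pos (proj₂ e) < pos (proj₁ e)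
  E0-tgt<src e∈ = +<+ (ℕ.s≤s (proj₁ (All.lookup (proj₁ valid) e∈)))

  E0-increasing : AllPairs (λ e e′ → (toℕ (proj₁ e) ℕ.< toℕ (proj₁ e′)) × (toℕ (proj₂ e) ℕ.< toℕ (proj₂ e′))) E0
  E0-increasing = Linked⇒AllPairs (λ (i< , j<) (i<′ , j<′) → ℕ.<-trans i< i<′ , ℕ.<-trans j< j<′) (proj₂ valid)

  E0-monotone : ∀ {e e′} → e ∈ E0 → e′ ∈ E0 → pos (proj₁ e) < pos (proj₁ e′) → pos (proj₂ e) < pos (proj₂ e′)
  E0-monotone e∈ e′∈ src< with AllPairs-trichotomy E0-increasing e∈ e′∈
  ... | inj₁ refl            = ⊥-elim (<-irrefl refl src<)
  ... | inj₂ (inj₁ (_ , j<)) = +<+ (ℕ.s≤s j<)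
  ... | inj₂ (inj₂ (i< , _)) = ⊥-elim (ℕ.<-asym (drop‿+<+ src<) (ℕ.s≤s i<))

  tgt<src : ∀ {I J} → InE L E0 I J → J < I
  tgt<src (inj₁ (_ , e∈ , refl , refl)) = E0-tgt<src e∈
  tgt<src {I} (inj₂ (_ , refl))         = i-1<i I

  monotone : ∀ {I J I′ J′} → InE L E0 I J → InE L E0 I′ J′ → I < I′ → J < J′
  monotone (inj₁ (_ , e∈ , refl , refl)) (inj₁ (_ , e′∈ , refl , refl)) I<I′ = E0-monotone e∈ e′∈ I<I′
  monotone (inj₁ (_ , e∈ , refl , refl)) (inj₂ (_ , refl)) I<I′ = <-≤-trans (E0-tgt<src e∈) (i<j⇒i≤j-1 I<I′)
  monotone (inj₂ (inj₁ L<I , refl)) (inj₁ ((i , _) , _ , refl , refl)) I<I′ =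
    ⊥-elim (<⇒≱ I<I′ (≤-trans (pos≤L i) (<⇒≤ L<I)))
  monotone {I} (inj₂ (inj₂ I≤1 , refl)) (inj₁ ((_ , j) , _ , refl , refl)) _ =
    <-≤-trans (i-1<i I) (≤-trans I≤1 (1≤pos j))
  monotone (inj₂ (_ , refl)) (inj₂ (_ , refl)) I<I′ = +-monoˡ-< (- + 1) I<I′

lemma4p7 : {A : Set} (L : ℕ) → 1 Data.Nat.≤ L → (X : Vec A L) (E0 : List (Edge L)) →
    ValidE0 L X E0 →
    Σ (ℤ → ℤ) λ predL → Σ (ℤ → ℤ) λ predR →
      (∀ I → (predL I ≤ predR I) × (predR I ≤ I - + 1)
           × (∀ J → Stable L E0 J (I - + 1) ⇔ ((predL I ≤ J) × (J ≤ predR I))))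
      × (∀ I → predL I ≤ predL (I + + 1))
      × (∀ I → predR I ≤ predR (I + + 1))
lemma4p7 L _ X E0 valid =
  (λ I → predL (I - + 1)) , (λ I → predR (I - + 1)) ,
  (λ I → predL≤predR (I - + 1) , predR≤r (I - + 1) , λ J → stable⇔ J (I - + 1)) ,
  (λ I → predL-mono (I-1≤[I+1]-1 I)) ,
  (λ I → predR-mono (I-1≤[I+1]-1 I))
  where
  -- InE L E0 unfolds to ListEdges source target E0 ∪ Boundary L, and Stable to IsStable.
  source target : Edge L → ℤ
  source e = pos (proj₁ e)
  target e = pos (proj₂ e)
  open ValidEdges X valid using (tgt<src; monotone)
  open StableSegments (InE L E0) tgt<src monotone
    (λ r → lastEdgeUpTo-∪ source target E0 (lastBoundaryUpTo L r))
    (λ r → firstEdgeAfter-∪ source target E0 (firstBoundaryAfter L r))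
  I-1≤[I+1]-1 : ∀ I → I - + 1 ≤ I + + 1 - + 1
  I-1≤[I+1]-1 I = +-monoˡ-≤ (- + 1) (i≤i+j I (+ 1))
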